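{- Let $G$ be a twin-free finite simple graph with no isolated vertices such that $\det(G) = k \geq 2$. Then for every integer $t \geq k-1$, \[ \det(\mu^{(t)}(G)) = k, \quad \dist(\mu^{(t)}(G)) = 2, \quad \text{and} \quad \rho(\mu^{(t)}(G)) = k. \]
   Context: For $t \in \mathbb{N}$ and a graph $G$ with $V(G)=\{v_1,\dots,v_n\}$, the generalized Mycielskian $\mu^{(t)}(G)$ has vertex set $\{u_i^s : 1\le i\le n,\ 0\le s\le t\} \cup \{w\}$, with $u_i^0$ identified with $v_i$. For each edge $v_iv_j$ of $G$ it has edges $u_i^0u_j^0$ and $u_i^su_j^{s+1}$, $u_j^su_i^{s+1}$ for $0 \le s < t$; also edges $u_i^t w$ for $1 \le i \le n$; no other edges. A determining set of a graph $H$ is a vertex set $S$ such that the only automorphism fixing every vertex of $S$ is the identity; $\det(H)$ is the minimum size of one. A coloring of $V(H)$ with $d$ colors is distinguishing if only the identity automorphism preserves each color class; $\dist(H)$ is the least $d$ admitting a distinguishing $d$-coloring. If $\dist(H)=2$, the cost $\rho(H)$ is the minimum, over all distinguishing $2$-colorings, of the size of the smaller color class. Twins are vertices with equal open neighborhoods; twin-free means no pair of distinct twins. -}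

module Defs where

open import Data.Nat using (ℕ; zero; suc; _+_; _*_; _≤_; _<_; _⊓_)
open import Data.Nat.Properties using (_≟_)
open import Data.Bool using (Bool; true; false; _∧_; _∨_)
open import Data.Fin using (Fin; zero; suc; toℕ; remQuot)
open import Data.Fin.Subset using (Subset; _∈_; ∣_∣)
open import Data.Fin.Permutation using (Permutation′; _⟨$⟩ʳ_)
open import Data.List using (length; filter)
open import Data.List.Base using () renaming (allFin to allFinL)
open import Data.Product using (Σ; _×_; _,_; proj₁; proj₂; ∃)
open import Relation.Nullary using (¬_; does)
open import Relation.Binary.PropositionalEquality using (_≡_)
import Data.Fin as F

Adj : ℕ → Set
Adj n = Fin n → Fin n → Bool

record SimpleGraph (n : ℕ) : Set where
  field
    adj   : Adj n
    sym   : ∀ i j → adj i j ≡ adj j i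
    loopless : ∀ i → adj i i ≡ false
open SimpleGraph public

TwinFree : ∀ {n} → SimpleGraph n → Set
TwinFree {n} G = ∀ (i j : Fin n) → (∀ x → adj G i x ≡ adj G j x) → i ≡ j

NoIsolated : ∀ {n} → SimpleGraph n → Set
NoIsolated {n} G = ∀ (i : Fin n) → ∃ λ j → adj G i j ≡ true

IsAut : ∀ {N} → Adj N → Permutation′ N → Set
IsAut A σ = ∀ i j → A (σ ⟨$⟩ʳ i) (σ ⟨$⟩ʳ j) ≡ A i j

Determining : ∀ {N} → Adj N → Subset N → Set
Determining {N} A S = ∀ (σ : Permutation′ N) → IsAut A σ →
  (∀ i → i ∈ S → σ ⟨$⟩ʳ i ≡ i) → ∀ i → σ ⟨$⟩ʳ i ≡ i

DetEq : ∀ {N} → Adj N → ℕ → Set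
DetEq {N} A k = (Σ (Subset N) λ S → Determining A S × ∣ S ∣ ≡ k)
              × (∀ (S : Subset N) → Determining A S → k ≤ ∣ S ∣)

Distinguishing : ∀ {N d} → Adj N → (Fin N → Fin d) → Set
Distinguishing {N} A c = ∀ (σ : Permutation′ N) → IsAut A σ →
  (∀ i → c (σ ⟨$⟩ʳ i) ≡ c i) → ∀ i → σ ⟨$⟩ʳ i ≡ i

DistEq : ∀ {N} → Adj N → ℕ → Set
DistEq {N} A d = (Σ (Fin N → Fin d) λ c → Distinguishing A c)
               × (∀ d′ → d′ < d → ¬ (Σ (Fin N → Fin d′) λ c → Distinguishing A c))

classSize : ∀ {N d} → (Fin N → Fin d) → Fin d → ℕ
classSize {N} c b = length (filter (λ i → c i F.≟ b) (allFinL N))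

smaller : ∀ {N} → (Fin N → Fin 2) → ℕ
smaller c = classSize c zero ⊓ classSize c (suc zero)

-- ρ(H) = k (cost, meaningful when dist(H) = 2)
CostEq : ∀ {N} → Adj N → ℕ → Set
CostEq {N} A k = (Σ (Fin N → Fin 2) λ c → Distinguishing A c × smaller c ≡ k)
               × (∀ (c : Fin N → Fin 2) → Distinguishing A c → k ≤ smaller c)

-- Generalized Mycielskian μ^(t)(G).  Vertex set Fin (1 + (t+1)·n):
-- zero is w; suc x with remQuot n x = (s , i) is u_i^s  (s : Fin (suc t)).
data MVert (n t : ℕ) : Set where
  w : MVert n t
  u : Fin (suc t) → Fin n → MVert n t

decode : ∀ {n t} → Fin (suc (suc t * n)) → MVert n t
decode zero = w
decode {n} {t} (suc x) = u (proj₁ (remQuot {suc t} n x)) (proj₂ (remQuot {suc t} n x))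

adjMV : ∀ {n} (t : ℕ) → Adj n → MVert n t → MVert n t → Bool
adjMV t A w w = false
adjMV t A w (u s i) = does (toℕ s ≟ t)
adjMV t A (u s i) w = does (toℕ s ≟ t)
adjMV t A (u s i) (u r j) =
  A i j ∧ ((does (toℕ s ≟ 0) ∧ does (toℕ r ≟ 0))
           ∨ does (suc (toℕ s) ≟ toℕ r) ∨ does (suc (toℕ r) ≟ toℕ s))

mycielskian : ∀ {n} (t : ℕ) → SimpleGraph n → Adj (suc (suc t * n))
mycielskian t G x y = adjMV t (adj G) (decode x) (decode y)

-- Every automorphism of μ⁽ᵗ⁾(G), t ≥ 1, fixes the apex w. Indeed w has three neighbours
-- (G has at least three vertices, as 2 ≤ det(G) ≤ n − 1), and every neighbour y of w has
-- a "shadow": a non-neighbour of w adjacent to all of N(y) − w. No vertex u_i^s has both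
-- properties when G is twin-free: a shadow of a suitable neighbour of u_i^s would have to
-- be adjacent to u_i^s itself. Working down from layer t = N(w), every automorphism then
-- preserves each layer, and twin-freeness makes it act on every layer as it acts on layer 0,
-- so the automorphisms of μ⁽ᵗ⁾(G) are exactly the lifts of those of G. Hence projecting a
-- determining set to G gives det(μ⁽ᵗ⁾(G)) ≥ k. Conversely, putting the k vertices of a minimum
-- determining set of G on pairwise distinct layers (possible as t ≥ k − 1) gives a set T that
-- no non-trivial automorphism maps into itself: T is determining, its indicator is a
-- distinguishing 2-colouring, and as each colour class of a distinguishing 2-colouring is
-- determining, the smaller class has at least k elements.

module Submission where

open import Defs hiding (sym)
open import Data.Bool using (Bool; true; false; not; _∧_; _∨_)
open import Data.Bool.Properties using (∧-conicalˡ; ∧-conicalʳ; ∧-identityʳ; ∨-zeroʳ; T-≡; T-∨; T-∧)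
open import Data.Fin.Patterns using (0F; 1F; 2F)
open import Data.Fin as Fin using (Fin; zero; suc; toℕ; _>_; fromℕ; fromℕ<; combine; inject₁; inject≤)
open import Data.Fin.Properties
  using ( toℕ-injective; toℕ<n; toℕ≤n; toℕ≤pred[n]; toℕ-fromℕ; toℕ-fromℕ<; toℕ-inject₁; suc-injective
        ; any?; inject≤-injective; remQuot-combine; combine-remQuot)
open import Data.Fin.Subset using (Subset; inside; outside; _∈_; _∉_; ∣_∣; ⊥; ∁; ⁅_⁆; _∪_)
open import Data.Fin.Subset.Properties
  using ( ∉⊥; ∣⊥∣≡0; ∣p∣≤∣x∷p∣; ∣p∣≤n; ∣⁅x⁆∣≡1; ∣∁p∣≡n∸∣p∣; x∉p⇒x∈∁p; x≢y⇒x∉⁅y⁆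
        ; x∈⁅x⁆; x∈⁅y⁆⇒x≡y; x∈p∪q⁺; x∈p∪q⁻; ∪-identityˡ)
open import Data.Fin.Permutation using (Permutation′; permutation; _⟨$⟩ʳ_; _⟨$⟩ˡ_; inverseˡ; inverseʳ)
open import Data.List using (length; filter)
import Data.List as List
open import Data.Nat using (ℕ; zero; suc; pred; _+_; _*_; _∸_; _≤_; _<_; _⊓_; z≤n; s≤s)
import Data.Nat.Properties as ℕ
open import Data.Nat.Properties
  using ( _≟_; ≡ᵇ⇒≡; ≤-trans; ≤-reflexive; ≤-pred; ≤-<-trans; ≤∧≢⇒<; <⇒≢; 1+n≰n; n≤1+n; pred[n]≤n
        ; +-mono-≤; *-monoˡ-≤; *-identityˡ; ∸-monoˡ-≤; m≤n+m∸n; m+n≤o⇒m≤o∸n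
        ; m⊓n≤n; m≤n⇒m⊓n≡m; m≥n⇒m⊓n≡n; ⊓-glb)
open import Data.Product using (Σ; ∃; _×_; _,_; proj₁; proj₂)
open import Data.Sum using (_⊎_; inj₁; inj₂; [_,_])
open import Data.Vec using (_∷_; []; lookup; here; there)
import Data.Vec as Vec
open import Data.Vec.Properties using (lookup⇒[]=; []=⇒lookup; lookup∘tabulate; tabulate∘lookup; tabulate-cong; lookup-map)
open import Function using (id; _∘_; _↔_; mk↔ₛ′; Inverse; Equivalence; Injection)
open import Function.Properties.Inverse using (↔⇒↣)
open import Function.Construct.Composition using (_↔-∘_)
open import Function.Construct.Symmetry using (↔-sym)
open import Function.Definitions using (Injective)
open import Induction.WellFounded using (module All)
open import Data.Fin.Induction using (>-wellFounded; <-weakInduction)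
open import Relation.Nullary using (¬_; Dec; yes; no; does; contradiction)
open import Relation.Nullary.Decidable using (dec-true; dec-false; _×-dec_; ¬?)
open import Relation.Binary.PropositionalEquality
  using (_≡_; _≢_; refl; sym; trans; cong; cong₂; subst; subst₂; module ≡-Reasoning)

private
  variable
    m N : ℕ

∣⁅x⁆∪p∣≤1+∣p∣ : ∀ (x : Fin N) (p : Subset N) → ∣ ⁅ x ⁆ ∪ p ∣ ≤ suc ∣ p ∣
∣⁅x⁆∪p∣≤1+∣p∣ zero    (b ∷ p) rewrite ∪-identityˡ p = s≤s (∣p∣≤∣x∷p∣ b p)
∣⁅x⁆∪p∣≤1+∣p∣ (suc x) (inside  ∷ p) = s≤s (∣⁅x⁆∪p∣≤1+∣p∣ x p)
∣⁅x⁆∪p∣≤1+∣p∣ (suc x) (outside ∷ p) = ∣⁅x⁆∪p∣≤1+∣p∣ x p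

x∉p⇒∣⁅x⁆∪p∣≡1+∣p∣ : ∀ {x : Fin N} {p} → x ∉ p → ∣ ⁅ x ⁆ ∪ p ∣ ≡ suc ∣ p ∣
x∉p⇒∣⁅x⁆∪p∣≡1+∣p∣ {x = zero}  {inside  ∷ p} x∉p = contradiction here x∉p
x∉p⇒∣⁅x⁆∪p∣≡1+∣p∣ {x = zero}  {outside ∷ p} x∉p = cong suc (cong ∣_∣ (∪-identityˡ p))
x∉p⇒∣⁅x⁆∪p∣≡1+∣p∣ {x = suc x} {inside  ∷ p} x∉p = cong suc (x∉p⇒∣⁅x⁆∪p∣≡1+∣p∣ (x∉p ∘ there))
x∉p⇒∣⁅x⁆∪p∣≡1+∣p∣ {x = suc x} {outside ∷ p} x∉p = x∉p⇒∣⁅x⁆∪p∣≡1+∣p∣ (x∉p ∘ there)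

image : (Fin m → Fin N) → Subset m → Subset N
image h []            = ⊥
image h (inside  ∷ p) = ⁅ h zero ⁆ ∪ image (h ∘ suc) p
image h (outside ∷ p) = image (h ∘ suc) p

∈image⁺ : ∀ (h : Fin m → Fin N) {p x} → x ∈ p → h x ∈ image h p
∈image⁺ h {inside  ∷ p} here      = x∈p∪q⁺ (inj₁ (x∈⁅x⁆ (h zero)))
∈image⁺ h {inside  ∷ p} (there x∈p) = x∈p∪q⁺ (inj₂ (∈image⁺ (h ∘ suc) x∈p))
∈image⁺ h {outside ∷ p} (there x∈p) = ∈image⁺ (h ∘ suc) x∈p

∈image⁻ : ∀ (h : Fin m → Fin N) p {y} → y ∈ image h p → ∃ λ x → x ∈ p × h x ≡ y
∈image⁻ h [] y∈ = contradiction y∈ ∉⊥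
∈image⁻ h (inside ∷ p) y∈ with x∈p∪q⁻ ⁅ h zero ⁆ _ y∈
... | inj₁ y∈⁅h0⁆ = zero , here , sym (x∈⁅y⁆⇒x≡y _ y∈⁅h0⁆)
... | inj₂ y∈img with ∈image⁻ (h ∘ suc) p y∈img
...   | x , x∈p , hx≡y = suc x , there x∈p , hx≡y
∈image⁻ h (outside ∷ p) y∈ with ∈image⁻ (h ∘ suc) p y∈
... | x , x∈p , hx≡y = suc x , there x∈p , hx≡y

∣image∣≤∣p∣ : ∀ (h : Fin m → Fin N) p → ∣ image h p ∣ ≤ ∣ p ∣
∣image∣≤∣p∣ {N = N} h [] = ≤-reflexive (∣⊥∣≡0 N)
∣image∣≤∣p∣ h (inside  ∷ p) = ≤-trans (∣⁅x⁆∪p∣≤1+∣p∣ (h zero) _) (s≤s (∣image∣≤∣p∣ (h ∘ suc) p))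
∣image∣≤∣p∣ h (outside ∷ p) = ∣image∣≤∣p∣ (h ∘ suc) p

∣image∣≡∣p∣ : ∀ {h : Fin m → Fin N} → Injective _≡_ _≡_ h → ∀ p → ∣ image h p ∣ ≡ ∣ p ∣
∣image∣≡∣p∣ {N = N} inj [] = ∣⊥∣≡0 N
∣image∣≡∣p∣ {h = h} inj (inside  ∷ p) =
  trans (x∉p⇒∣⁅x⁆∪p∣≡1+∣p∣ h0∉) (cong suc (∣image∣≡∣p∣ (suc-injective ∘ inj) p))
  where
  h0∉ : h zero ∉ image (h ∘ suc) p
  h0∉ h0∈ with ∈image⁻ (h ∘ suc) p h0∈
  ... | x , _ , hx≡h0 with inj hx≡h0
  ... | ()
∣image∣≡∣p∣ inj (outside ∷ p) = ∣image∣≡∣p∣ (suc-injective ∘ inj) p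

rank : Subset m → Fin m → ℕ
rank (_       ∷ p) zero    = 0
rank (inside  ∷ p) (suc i) = suc (rank p i)
rank (outside ∷ p) (suc i) = rank p i

rank<∣p∣ : ∀ {p : Subset m} {i} → i ∈ p → rank p i < ∣ p ∣
rank<∣p∣ {p = inside  ∷ p} here        = s≤s z≤n
rank<∣p∣ {p = inside  ∷ p} (there i∈p) = s≤s (rank<∣p∣ i∈p)
rank<∣p∣ {p = outside ∷ p} (there i∈p) = rank<∣p∣ i∈p

rank-injective : ∀ {p : Subset m} {i j} → i ∈ p → j ∈ p → rank p i ≡ rank p j → i ≡ j
rank-injective {i = zero}  {zero}  _ _ _ = refl
rank-injective {p = inside  ∷ p} {zero}  {suc j} _ _ ()
rank-injective {p = inside  ∷ p} {suc i} {zero}  _ _ ()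
rank-injective {p = outside ∷ p} {zero}  {suc j} () _ _
rank-injective {p = outside ∷ p} {suc i} {zero}  _ () _
rank-injective {p = inside  ∷ p} {suc i} {suc j} (there i∈p) (there j∈p) eq =
  cong suc (rank-injective i∈p j∈p (ℕ.suc-injective eq))
rank-injective {p = outside ∷ p} {suc i} {suc j} (there i∈p) (there j∈p) eq =
  cong suc (rank-injective i∈p j∈p eq)

length-filter-tabulate : ∀ {A : Set} {P : A → Set} (P? : ∀ a → Dec (P a)) (h : Fin N → A) →
  length (filter P? (List.tabulate h)) ≡ ∣ Vec.tabulate (does ∘ P? ∘ h) ∣
length-filter-tabulate {N = zero}  P? h = refl
length-filter-tabulate {N = suc N} P? h with does (P? (h zero))
... | true  = cong suc (length-filter-tabulate P? (h ∘ suc))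
... | false = length-filter-tabulate P? (h ∘ suc)

Fin≤1-allEqual : ∀ {d} → d ≤ 1 → (a b : Fin d) → a ≡ b
Fin≤1-allEqual (s≤s z≤n) zero zero = refl

Fin2-≢⇒≡ : ∀ {a b c : Fin 2} → a ≢ c → b ≢ c → a ≡ b
Fin2-≢⇒≡ {zero}     {zero}     _   _   = refl
Fin2-≢⇒≡ {suc zero} {suc zero} _   _   = refl
Fin2-≢⇒≡ {zero}     {suc zero} {zero}     a≢c _   = contradiction refl a≢c
Fin2-≢⇒≡ {zero}     {suc zero} {suc zero} _   b≢c = contradiction refl b≢c
Fin2-≢⇒≡ {suc zero} {zero}     {zero}     _   b≢c = contradiction refl b≢c
Fin2-≢⇒≡ {suc zero} {zero}     {suc zero} a≢c _   = contradiction refl a≢c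

colourClass : ∀ {d} → (Fin N → Fin d) → Fin d → Subset N
colourClass c b = Vec.tabulate (λ x → does (c x Fin.≟ b))

classSize≡∣colourClass∣ : ∀ {d} (c : Fin N → Fin d) b → classSize c b ≡ ∣ colourClass c b ∣
classSize≡∣colourClass∣ c b = length-filter-tabulate (λ x → c x Fin.≟ b) id

∈colourClass : ∀ {d} {c : Fin N → Fin d} {b x} → c x ≡ b → x ∈ colourClass c b
∈colourClass {c = c} {b} {x} cx≡b =
  lookup⇒[]= x _ (trans (lookup∘tabulate _ x) (dec-true (c x Fin.≟ b) cx≡b))

bit : Bool → Fin 2
bit false = zero
bit true  = suc zero

indicator : Subset N → Fin N → Fin 2
indicator T = bit ∘ lookup T

colourClass-indicator-one : ∀ (T : Subset N) → colourClass (indicator T) (suc zero) ≡ T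
colourClass-indicator-one T = trans (tabulate-cong (λ x → is-one (lookup T x))) (tabulate∘lookup T)
  where
  is-one : ∀ b → does (bit b Fin.≟ suc zero) ≡ b
  is-one false = refl
  is-one true  = refl

colourClass-indicator-zero : ∀ (T : Subset N) → colourClass (indicator T) zero ≡ ∁ T
colourClass-indicator-zero T =
  trans (tabulate-cong (λ x → trans (is-zero (lookup T x)) (sym (lookup-map x not T)))) (tabulate∘lookup (∁ T))
  where
  is-zero : ∀ b → does (bit b Fin.≟ zero) ≡ not b
  is-zero false = refl
  is-zero true  = refl

module _ (A : Adj N) where

  Rigid : Subset N → Set
  Rigid T = ∀ σ → IsAut A σ → (∀ x → x ∈ T → σ ⟨$⟩ʳ x ∈ T) → ∀ x → σ ⟨$⟩ʳ x ≡ x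

  rigid⇒determining : ∀ {T} → Rigid T → Determining A T
  rigid⇒determining rigid σ σ-aut fixes =
    rigid σ σ-aut (λ x x∈T → subst (_∈ _) (sym (fixes x x∈T)) x∈T)

  rigid⇒distinguishing : ∀ {T} → Rigid T → Distinguishing A (indicator T)
  rigid⇒distinguishing {T} rigid σ σ-aut preserves = rigid σ σ-aut maps-into
    where
    maps-into : ∀ x → x ∈ T → σ ⟨$⟩ʳ x ∈ T
    maps-into x x∈T = lookup⇒[]= _ T (bit-injective (trans (preserves x) (cong bit ([]=⇒lookup x∈T))))
      where
      bit-injective : ∀ {a b} → bit a ≡ bit b → a ≡ b
      bit-injective {false} {false} _ = refl
      bit-injective {true}  {true}  _ = refl

  colourClass-determining : ∀ {c : Fin N → Fin 2} → Distinguishing A c → ∀ b → Determining A (colourClass c b)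
  colourClass-determining {c} c-dist b σ σ-aut fixes = c-dist σ σ-aut preserves
    where
    preserves : ∀ x → c (σ ⟨$⟩ʳ x) ≡ c x
    preserves x with c x Fin.≟ b
    ... | yes cx≡b = cong c (fixes x (∈colourClass {c = c} cx≡b))
    ... | no  cx≢b = Fin2-≢⇒≡ cσx≢b cx≢b
      where
      cσx≢b : c (σ ⟨$⟩ʳ x) ≢ b
      cσx≢b cσx≡b = cx≢b (subst (λ y → c y ≡ b) σx≡x cσx≡b)
        where
        σx≡x : σ ⟨$⟩ʳ x ≡ x
        σx≡x = Injection.injective (↔⇒↣ σ) (fixes _ (∈colourClass {c = c} cσx≡b))

  fewColours⇒∅-determining : ∀ {d} {c : Fin N → Fin d} → d ≤ 1 → Distinguishing A c → Determining A ⊥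
  fewColours⇒∅-determining d≤1 c-dist σ σ-aut _ = c-dist σ σ-aut (λ x → Fin≤1-allEqual d≤1 _ _)

  ∁⁅x⁆-determining : ∀ x → Determining A (∁ ⁅ x ⁆)
  ∁⁅x⁆-determining x σ _ fixes i with i Fin.≟ x
  ... | no i≢x = fixes i (x∉p⇒x∈∁p (x≢y⇒x∉⁅y⁆ i≢x))
  ... | yes refl with σ ⟨$⟩ʳ i Fin.≟ i
  ...   | yes σi≡i = σi≡i
  ...   | no  σi≢i =
    contradiction (Injection.injective (↔⇒↣ σ) (fixes (σ ⟨$⟩ʳ i) (x∉p⇒x∈∁p (x≢y⇒x∉⁅y⁆ σi≢i)))) σi≢i

  module _ {k} (minimal : ∀ S → Determining A S → k ≤ ∣ S ∣) where

    cost-lowerBound : ∀ c → Distinguishing A c → k ≤ smaller c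
    cost-lowerBound c c-dist = ⊓-glb (class-lowerBound zero) (class-lowerBound (suc zero))
      where
      class-lowerBound : ∀ b → k ≤ classSize c b
      class-lowerBound b = subst (k ≤_) (sym (classSize≡∣colourClass∣ c b))
        (minimal _ (colourClass-determining c-dist b))

    rigid-detEq : ∀ {T} → Rigid T → ∣ T ∣ ≡ k → DetEq A k
    rigid-detEq {T} rigid ∣T∣≡k = (T , rigid⇒determining rigid , ∣T∣≡k) , minimal

    rigid-distEq : ∀ {T} → Rigid T → 1 ≤ k → DistEq A 2
    rigid-distEq {T} rigid 1≤k = (indicator T , rigid⇒distinguishing rigid) , fewer
      where
      fewer : ∀ d → d < 2 → ¬ (Σ (Fin N → Fin d) (Distinguishing A))
      fewer d (s≤s d≤1) (c , c-dist) = contradiction (≤-trans 1≤k k≤0) λ ()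
        where
        k≤0 : k ≤ 0
        k≤0 = ≤-trans (minimal ⊥ (fewColours⇒∅-determining d≤1 c-dist)) (≤-reflexive (∣⊥∣≡0 N))

    rigid-costEq : ∀ {T} → Rigid T → ∣ T ∣ ≡ k → k ≤ N ∸ k → CostEq A k
    rigid-costEq {T} rigid ∣T∣≡k k≤N∸k = (indicator T , rigid⇒distinguishing rigid , smaller≡k) , cost-lowerBound
      where
      open ≡-Reasoning
      smaller≡k : smaller (indicator T) ≡ k
      smaller≡k = begin
        classSize (indicator T) zero ⊓ classSize (indicator T) (suc zero)
          ≡⟨ cong₂ _⊓_ (classSize≡∣colourClass∣ (indicator T) zero) (classSize≡∣colourClass∣ (indicator T) (suc zero)) ⟩
        ∣ colourClass (indicator T) zero ∣ ⊓ ∣ colourClass (indicator T) (suc zero) ∣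
          ≡⟨ cong₂ (λ p q → ∣ p ∣ ⊓ ∣ q ∣) (colourClass-indicator-zero T) (colourClass-indicator-one T) ⟩
        ∣ ∁ T ∣ ⊓ ∣ T ∣
          ≡⟨ cong₂ _⊓_ (trans (∣∁p∣≡n∸∣p∣ T) (cong (N ∸_) ∣T∣≡k)) ∣T∣≡k ⟩
        (N ∸ k) ⊓ k
          ≡⟨ m≥n⇒m⊓n≡n k≤N∸k ⟩
        k ∎

det<N : ∀ {A : Adj N} {k} → DetEq A k → 1 ≤ k → k < N
det<N {zero}  ((S , _ , ∣S∣≡k) , _) 1≤k =
  contradiction (≤-trans 1≤k (≤-trans (≤-reflexive (sym ∣S∣≡k)) (∣p∣≤n S))) λ ()
det<N {suc N} {A} (_ , minimal) _ = s≤s (≤-trans (minimal _ (∁⁅x⁆-determining A zero))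
  (≤-reflexive (trans (∣∁p∣≡n∸∣p∣ (⁅_⁆ {suc N} zero)) (cong (suc N ∸_) (∣⁅x⁆∣≡1 {suc N} zero)))))

module _ {n} (G : SimpleGraph n) where

  TwoNeighbours : Fin n → Set
  TwoNeighbours i = Σ (Fin n) λ j₁ → Σ (Fin n) λ j₂ → j₁ ≢ j₂ × adj G i j₁ ≡ true × adj G i j₂ ≡ true

  Path₂ : Fin n → Set
  Path₂ i = Σ (Fin n) λ j → Σ (Fin n) λ l → adj G i j ≡ true × adj G j l ≡ true × l ≢ i

  private
    OtherNeighbour : Fin n → Fin n → Set
    OtherNeighbour i j = ∃ λ l → adj G j l ≡ true × l ≢ i

    otherNeighbour? : ∀ i j → Dec (OtherNeighbour i j)
    otherNeighbour? i j = any? (λ l → (adj G j l Data.Bool.≟ true) ×-dec ¬? (l Fin.≟ i))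

    pendant : ∀ {i j} → adj G i j ≡ true → ¬ OtherNeighbour i j → ∀ x → adj G j x ≡ does (x Fin.≟ i)
    pendant {i} {j} i~j none x with x Fin.≟ i
    ... | yes refl = trans (SimpleGraph.sym G j i) i~j
    ... | no  x≢i with adj G j x in j~x
    ...   | true  = contradiction (x , j~x , x≢i) none
    ...   | false = refl

  twinFree⇒path₂ : TwinFree G → ∀ {i} → TwoNeighbours i → Path₂ i
  twinFree⇒path₂ twin-free {i} (j₁ , j₂ , j₁≢j₂ , i~j₁ , i~j₂) with otherNeighbour? i j₁ | otherNeighbour? i j₂
  ... | yes (l , j₁~l , l≢i) | _                    = j₁ , l , i~j₁ , j₁~l , l≢i
  ... | no _                 | yes (l , j₂~l , l≢i) = j₂ , l , i~j₂ , j₂~l , l≢i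
  ... | no none₁             | no none₂             =
    contradiction (twin-free j₁ j₂ λ x → trans (pendant i~j₁ none₁ x) (sym (pendant i~j₂ none₂ x))) j₁≢j₂

data LayerAdj : ℕ → ℕ → Set where
  bottom : LayerAdj 0 0
  up     : ∀ s → LayerAdj s (suc s)
  down   : ∀ s → LayerAdj (suc s) s

-- the layer condition of adjMV, verbatim
layerAdjᵇ : ℕ → ℕ → Bool
layerAdjᵇ s r = (does (s ≟ 0) ∧ does (r ≟ 0)) ∨ does (suc s ≟ r) ∨ does (suc r ≟ s)

layerAdjᵇ-complete : ∀ {s r} → LayerAdj s r → layerAdjᵇ s r ≡ true
layerAdjᵇ-complete bottom   = refl
layerAdjᵇ-complete (up s)   = trans (cong (λ b → (does (s ≟ 0) ∧ false) ∨ b ∨ does (suc (suc s) ≟ s))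
  (dec-true (suc s ≟ suc s) refl)) (∨-zeroʳ _)
layerAdjᵇ-complete (down r) = trans (cong (λ b → (false ∧ does (r ≟ 0)) ∨ does (suc (suc r) ≟ r) ∨ b)
  (dec-true (suc r ≟ suc r) refl)) (∨-zeroʳ (does (suc (suc r) ≟ r)))

layerAdjᵇ-sound : ∀ s r → layerAdjᵇ s r ≡ true → LayerAdj s r
layerAdjᵇ-sound s r eq with Equivalence.to T-∨ (Equivalence.from T-≡ eq)
... | inj₁ bottom? with Equivalence.to T-∧ bottom?
...   | s≡0 , r≡0 = subst₂ LayerAdj (sym (≡ᵇ⇒≡ s 0 s≡0)) (sym (≡ᵇ⇒≡ r 0 r≡0)) bottom
layerAdjᵇ-sound s r eq | inj₂ up⊎down with Equivalence.to T-∨ up⊎down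
...   | inj₁ 1+s≡r = subst (LayerAdj s) (≡ᵇ⇒≡ (suc s) r 1+s≡r) (up s)
...   | inj₂ 1+r≡s = subst (λ s → LayerAdj s r) (≡ᵇ⇒≡ (suc r) s 1+r≡s) (down r)

layerAdj-sym : ∀ {s r} → LayerAdj s r → LayerAdj r s
layerAdj-sym bottom   = bottom
layerAdj-sym (up s)   = down s
layerAdj-sym (down s) = up s

layerAdj-pred : ∀ s → LayerAdj (pred s) s
layerAdj-pred zero    = bottom
layerAdj-pred (suc s) = up s

layerAdj⇒suc⊎pred : ∀ {s r} → LayerAdj s r → r ≡ suc s ⊎ r ≡ pred s
layerAdj⇒suc⊎pred bottom   = inj₂ refl
layerAdj⇒suc⊎pred (up s)   = inj₁ refl
layerAdj⇒suc⊎pred (down s) = inj₂ refl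

layerAdj-atMostTwo : ∀ {s a b c} → LayerAdj s a → LayerAdj s b → LayerAdj s c → a ≡ b ⊎ a ≡ c ⊎ b ≡ c
layerAdj-atMostTwo a~ b~ c~ = pigeonhole (layerAdj⇒suc⊎pred a~) (layerAdj⇒suc⊎pred b~) (layerAdj⇒suc⊎pred c~)
  where
  pigeonhole : ∀ {x y a b c : ℕ} → a ≡ x ⊎ a ≡ y → b ≡ x ⊎ b ≡ y → c ≡ x ⊎ c ≡ y → a ≡ b ⊎ a ≡ c ⊎ b ≡ c
  pigeonhole (inj₁ a≡x) (inj₁ b≡x) _          = inj₁ (trans a≡x (sym b≡x))
  pigeonhole (inj₂ a≡y) (inj₂ b≡y) _          = inj₁ (trans a≡y (sym b≡y))
  pigeonhole (inj₁ a≡x) (inj₂ _)   (inj₁ c≡x) = inj₂ (inj₁ (trans a≡x (sym c≡x)))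
  pigeonhole (inj₂ a≡y) (inj₁ _)   (inj₂ c≡y) = inj₂ (inj₁ (trans a≡y (sym c≡y)))
  pigeonhole (inj₁ _)   (inj₂ b≡y) (inj₂ c≡y) = inj₂ (inj₂ (trans b≡y (sym c≡y)))
  pigeonhole (inj₂ _)   (inj₁ b≡x) (inj₁ c≡x) = inj₂ (inj₂ (trans b≡x (sym c≡x)))

layerAdj-below : ∀ {s r} → 1 ≤ s → r ≤ s → LayerAdj s r → r ≡ pred s
layerAdj-below () _ bottom
layerAdj-below _ r≤s (up s) = contradiction r≤s 1+n≰n
layerAdj-below _ _ (down s) = refl

layerAt : ∀ {t} m → m ≤ t → Fin (suc t)
layerAt m m≤t = fromℕ< (s≤s m≤t)

toℕ-layerAt : ∀ {t} m (m≤t : m ≤ t) → toℕ (layerAt m m≤t) ≡ m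
toℕ-layerAt m m≤t = toℕ-fromℕ< (s≤s m≤t)

layerAdj-suc-inject₁ : ∀ {t} (s : Fin t) → LayerAdj (toℕ (suc s)) (toℕ (inject₁ s))
layerAdj-suc-inject₁ s = subst (LayerAdj (suc (toℕ s))) (sym (toℕ-inject₁ s)) (down (toℕ s))

layerAdj-suc : ∀ {s r} → LayerAdj r (suc s) → r ≡ s ⊎ r ≡ suc (suc s)
layerAdj-suc (up s)   = inj₁ refl
layerAdj-suc (down _) = inj₂ refl

record Automorphism {V : Set} (E : V → V → Bool) : Set where
  field
    bijection : V ↔ V
    preserves : ∀ a b → E (Inverse.to bijection a) (Inverse.to bijection b) ≡ E a b
  open Inverse bijection public using (to; from; strictlyInverseˡ; strictlyInverseʳ)

  to-injective : ∀ {a b} → to a ≡ to b → a ≡ b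
  to-injective = Injection.injective (↔⇒↣ bijection)

open Automorphism using (to; from; preserves; to-injective; strictlyInverseˡ; strictlyInverseʳ)

module _ {V : Set} {E : V → V → Bool} where

  inverse : Automorphism E → Automorphism E
  inverse F = record
    { bijection = ↔-sym (Automorphism.bijection F)
    ; preserves = λ a b → trans (sym (preserves F (from F a) (from F b)))
                                (cong₂ E (strictlyInverseˡ F a) (strictlyInverseˡ F b))
    }

module _ {V : Set} (E : V → V → Bool) where

  ThreeNeighbours : V → Set
  ThreeNeighbours x = Σ V λ y₁ → Σ V λ y₂ → Σ V λ y₃ →
    (E x y₁ ≡ true × E x y₂ ≡ true × E x y₃ ≡ true) × (y₁ ≢ y₂ × y₁ ≢ y₃ × y₂ ≢ y₃)

  Shadowed : V → Set
  Shadowed x = ∀ y → E x y ≡ true →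
    ∃ λ z → E z x ≡ false × (∀ v → E y v ≡ true → v ≢ x → E z v ≡ true)

module _ {V : Set} {E : V → V → Bool} (F : Automorphism E) where

  adjacent-from : ∀ {x y} → E (to F x) y ≡ true → E x (from F y) ≡ true
  adjacent-from {x} {y} Fx~y =
    trans (cong (λ a → E a (from F y)) (sym (strictlyInverseʳ F x))) (trans (preserves (inverse F) (to F x) y) Fx~y)

  threeNeighbours-preserved : ∀ {x} → ThreeNeighbours E x → ThreeNeighbours E (to F x)
  threeNeighbours-preserved {x} (y₁ , y₂ , y₃ , (x~y₁ , x~y₂ , x~y₃) , (y₁≢y₂ , y₁≢y₃ , y₂≢y₃)) =
    to F y₁ , to F y₂ , to F y₃ ,
    (trans (preserves F x y₁) x~y₁ , trans (preserves F x y₂) x~y₂ , trans (preserves F x y₃) x~y₃) ,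
    (y₁≢y₂ ∘ to-injective F , y₁≢y₃ ∘ to-injective F , y₂≢y₃ ∘ to-injective F)

  shadowed-preserved : ∀ {x} → Shadowed E x → Shadowed E (to F x)
  shadowed-preserved {x} x-shadowed y Fx~y with x-shadowed (from F y) (adjacent-from Fx~y)
  ... | z , z≁x , z-covers = to F z , trans (preserves F z x) z≁x , Fz-covers
    where
    Fz-covers : ∀ v → E y v ≡ true → v ≢ to F x → E (to F z) v ≡ true
    Fz-covers v y~v v≢Fx = begin
      E (to F z) v                   ≡⟨ cong (E (to F z)) (sym (strictlyInverseˡ F v)) ⟩
      E (to F z) (to F (from F v))   ≡⟨ preserves F z (from F v) ⟩
      E z (from F v)                 ≡⟨ z-covers (from F v) (trans (preserves (inverse F) y v) y~v) F⁻¹v≢x ⟩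
      true                           ∎
      where
      open ≡-Reasoning
      F⁻¹v≢x : from F v ≢ x
      F⁻¹v≢x eq = v≢Fx (trans (sym (strictlyInverseˡ F v)) (cong (to F) eq))

u-injectiveˡ : ∀ {n t} {s r : Fin (suc t)} {i j : Fin n} → u {n} {t} s i ≡ u r j → s ≡ r
u-injectiveˡ refl = refl

u-injectiveʳ : ∀ {n t} {s r : Fin (suc t)} {i j : Fin n} → u {n} {t} s i ≡ u r j → i ≡ j
u-injectiveʳ refl = refl

module VertexCode (n t : ℕ) where

  encode : MVert n t → Fin (suc (suc t * n))
  encode w       = zero
  encode (u s i) = suc (combine s i)

  decode-encode : ∀ v → decode (encode v) ≡ v
  decode-encode w       = refl
  decode-encode (u s i) = cong (λ (s , i) → u s i) (remQuot-combine {suc t} {n} s i)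

  encode-decode : ∀ x → encode (decode x) ≡ x
  encode-decode zero    = refl
  encode-decode (suc x) = cong suc (combine-remQuot {suc t} n x)

  encode-injective : ∀ {a b} → encode a ≡ encode b → a ≡ b
  encode-injective {a} {b} eq = trans (sym (decode-encode a)) (trans (cong decode eq) (decode-encode b))

  vertexCode : MVert n t ↔ Fin (suc (suc t * n))
  vertexCode = mk↔ₛ′ encode decode encode-decode decode-encode

  mapVertex : (Fin n → Fin n) → MVert n t → MVert n t
  mapVertex p w       = w
  mapVertex p (u s i) = u s (p i)

  mapVertex↔ : Permutation′ n → MVert n t ↔ MVert n t
  mapVertex↔ π = mk↔ₛ′ (mapVertex (π ⟨$⟩ʳ_)) (mapVertex (π ⟨$⟩ˡ_)) (cancel (inverseʳ π)) (cancel (inverseˡ π))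
    where
    cancel : ∀ {p q : Fin n → Fin n} → (∀ {i} → p (q i) ≡ i) → ∀ v → mapVertex p (mapVertex q v) ≡ v
    cancel pq w       = refl
    cancel pq (u s i) = cong (u s) pq

  mapVertex-fixes : ∀ {p : Fin n → Fin n} v → (∀ {s i} → v ≡ u s i → p i ≡ i) → mapVertex p v ≡ v
  mapVertex-fixes w       _     = refl
  mapVertex-fixes (u s i) fixes = cong (u s) (fixes refl)

module MycielskianAdjacency {n : ℕ} (A : Adj n) (t : ℕ) where

  open VertexCode n t

  private
    _~_ : MVert n t → MVert n t → Bool
    _~_ = adjMV t A

  ~-layerAdj : ∀ s r {i j} → LayerAdj (toℕ s) (toℕ r) → u s i ~ u r j ≡ A i j
  ~-layerAdj s r {i} {j} s~r = trans (cong (A i j ∧_) (layerAdjᵇ-complete s~r)) (∧-identityʳ (A i j))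

  ~⇒layerAdj : ∀ s r {i j} → u s i ~ u r j ≡ true → A i j ≡ true × LayerAdj (toℕ s) (toℕ r)
  ~⇒layerAdj s r {i} {j} eq = ∧-conicalˡ (A i j) _ eq , layerAdjᵇ-sound (toℕ s) (toℕ r) (∧-conicalʳ (A i j) _ eq)

  apex~ : ∀ s i → toℕ s ≡ t → w ~ u s i ≡ true
  apex~ s _ s≡t = dec-true (toℕ s ≟ t) s≡t

  apex≁ : ∀ s i → toℕ s ≢ t → w ~ u s i ≡ false
  apex≁ s _ s≢t = dec-false (toℕ s ≟ t) s≢t

  apex~⇒top : ∀ s i → w ~ u s i ≡ true → toℕ s ≡ t
  apex~⇒top s _ eq = ≡ᵇ⇒≡ (toℕ s) t (Equivalence.from T-≡ eq)

  mapVertex-preserves : ∀ (π : Permutation′ n) → IsAut A π →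
                        ∀ a b → mapVertex (π ⟨$⟩ʳ_) a ~ mapVertex (π ⟨$⟩ʳ_) b ≡ a ~ b
  mapVertex-preserves π π-aut w       w       = refl
  mapVertex-preserves π π-aut w       (u s i) = refl
  mapVertex-preserves π π-aut (u s i) w       = refl
  mapVertex-preserves π π-aut (u s i) (u r j) = cong (_∧ layerAdjᵇ (toℕ s) (toℕ r)) (π-aut i j)

-- Automorphisms of μ⁽ᵗ⁾(G) are lifts

module MycielskianPermutations {n} (G : SimpleGraph n) (t : ℕ) where

  open VertexCode n t
  open MycielskianAdjacency (adj G) t

  lift : Permutation′ n → Permutation′ (suc (suc t * n))
  lift π = vertexCode ↔-∘ (mapVertex↔ π ↔-∘ ↔-sym vertexCode)

  lift-isAut : ∀ {π} → IsAut (adj G) π → IsAut (mycielskian t G) (lift π)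
  lift-isAut {π} π-aut x y =
    trans (cong₂ (adjMV t (adj G)) (decode-encode (πx x)) (decode-encode (πx y))) (mapVertex-preserves π π-aut (decode x) (decode y))
    where
    πx : Fin (suc (suc t * n)) → MVert n t
    πx x = mapVertex (π ⟨$⟩ʳ_) (decode x)

  lift-u : ∀ π s i → lift π ⟨$⟩ʳ encode (u s i) ≡ encode (u s (π ⟨$⟩ʳ i))
  lift-u π s i = cong (encode ∘ mapVertex (π ⟨$⟩ʳ_)) (decode-encode (u s i))

  lift-fixes : ∀ {π} x → (∀ {s i} → decode x ≡ u s i → π ⟨$⟩ʳ i ≡ i) → lift π ⟨$⟩ʳ x ≡ x
  lift-fixes {π} x fixes = trans (cong encode (mapVertex-fixes (decode x) fixes)) (encode-decode x)

  lift-identity⁻¹ : ∀ {π} → (∀ x → lift π ⟨$⟩ʳ x ≡ x) → ∀ i → π ⟨$⟩ʳ i ≡ i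
  lift-identity⁻¹ {π} lift-id i =
    u-injectiveʳ (encode-injective {u zero (π ⟨$⟩ʳ i)} {u zero i} (trans (sym (lift-u π zero i)) (lift-id (encode (u zero i)))))

  asAutomorphism : ∀ σ → IsAut (mycielskian t G) σ → Automorphism (adjMV t (adj G))
  asAutomorphism σ σ-aut = record
    { bijection = ↔-sym vertexCode ↔-∘ (σ ↔-∘ vertexCode)
    ; preserves = λ a b → trans (σ-aut (encode a) (encode b)) (cong₂ (adjMV t (adj G)) (decode-encode a) (decode-encode b))
    }

module MycielskianAutomorphisms {n} (G : SimpleGraph n) {t} (1≤t : 1 ≤ t) where

  private
    _~_ : MVert n t → MVert n t → Bool
    _~_ = adjMV t (adj G)

  open VertexCode n t
  open MycielskianAdjacency (adj G) t
  open MycielskianPermutations G t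

  apex-shadowed : Shadowed _~_ w
  apex-shadowed (u s i) w~y = u below i , apex≁ below i below≢t , covers
    where
    s≡t : toℕ s ≡ t
    s≡t = apex~⇒top s i w~y
    below≤t : pred (pred t) ≤ t
    below≤t = ≤-trans pred[n]≤n pred[n]≤n
    below : Fin (suc t)
    below = layerAt (pred (pred t)) below≤t
    toℕ-below : toℕ below ≡ pred (pred t)
    toℕ-below = toℕ-layerAt (pred (pred t)) below≤t
    below≢t : toℕ below ≢ t
    below≢t eq = <⇒≢ (pred-pred<  1≤t) (trans (sym toℕ-below) eq)
      where
      pred-pred< : ∀ {m} → 1 ≤ m → pred (pred m) < m
      pred-pred< {suc zero}    _ = s≤s z≤n
      pred-pred< {suc (suc m)} _ = s≤s (n≤1+n m)
    covers : ∀ v → u s i ~ v ≡ true → v ≢ w → u below i ~ v ≡ true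
    covers w       _   v≢w = contradiction refl v≢w
    covers (u r j) y~v _   = trans (~-layerAdj below r below~r) i~j
      where
      i~j = proj₁ (~⇒layerAdj s r y~v)
      r≡pred-t : toℕ r ≡ pred t
      r≡pred-t = layerAdj-below 1≤t (toℕ≤pred[n] r) (subst (λ a → LayerAdj a (toℕ r)) s≡t (proj₂ (~⇒layerAdj s r y~v)))
      below~r : LayerAdj (toℕ below) (toℕ r)
      below~r = subst₂ LayerAdj (sym toℕ-below) (sym r≡pred-t) (layerAdj-pred (pred t))

  apex-threeNeighbours : 3 ≤ n → ThreeNeighbours _~_ w
  apex-threeNeighbours 3≤n =
    u top (vertex 0F) , u top (vertex 1F) , u top (vertex 2F) , (top~ (vertex 0F) , top~ (vertex 1F) , top~ (vertex 2F)) ,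
    (distinct (λ ()) , distinct (λ ()) , distinct (λ ()))
    where
    top : Fin (suc t)
    top = fromℕ t
    top~ : ∀ i → w ~ u top i ≡ true
    top~ i = apex~ top i (toℕ-fromℕ t)
    vertex : Fin 3 → Fin n
    vertex a = inject≤ a 3≤n
    distinct : ∀ {a b : Fin 3} → a ≢ b → u top (vertex a) ≢ u top (vertex b)
    distinct a≢b = a≢b ∘ inject≤-injective 3≤n 3≤n _ _ ∘ u-injectiveʳ

  private
    neighbourOf : ∀ s r {i j} → u s i ~ u r j ≡ true → adj G i j ≡ true
    neighbourOf s r = proj₁ ∘ ~⇒layerAdj s r

    layerOf : ∀ s r {i j} → u s i ~ u r j ≡ true → LayerAdj (toℕ s) (toℕ r)
    layerOf s r = proj₂ ∘ ~⇒layerAdj s r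

    topNeighbours : ∀ s {i r₁ r₂ j₁ j₂} → toℕ s ≡ t → u s i ~ u r₁ j₁ ≡ true → u s i ~ u r₂ j₂ ≡ true →
                    u r₁ j₁ ≢ u r₂ j₂ → TwoNeighbours G i
    topNeighbours s {r₁ = r₁} {r₂} {j₁} {j₂} s≡t x~y₁ x~y₂ y₁≢y₂ with j₁ Fin.≟ j₂
    ... | no j₁≢j₂ = j₁ , j₂ , j₁≢j₂ , neighbourOf s r₁ x~y₁ , neighbourOf s r₂ x~y₂
    ... | yes refl =
      contradiction (cong (λ r → u r j₁) (toℕ-injective (trans (belowTop r₁ x~y₁) (sym (belowTop r₂ x~y₂))))) y₁≢y₂
      where
      belowTop : ∀ r {j} → u s _ ~ u r j ≡ true → toℕ r ≡ pred t
      belowTop r x~y = layerAdj-below 1≤t (toℕ≤pred[n] r) (subst (λ a → LayerAdj a (toℕ r)) s≡t (layerOf s r x~y))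

  layer-twoNeighbours : ∀ s i → ThreeNeighbours _~_ (u s i) → TwoNeighbours G i
  layer-twoNeighbours s i (w , w , _ , _ , (y₁≢y₂ , _)) = contradiction refl y₁≢y₂
  layer-twoNeighbours s i (w , u _ _ , w , _ , (_ , y₁≢y₃ , _)) = contradiction refl y₁≢y₃
  layer-twoNeighbours s i (u _ _ , w , w , _ , (_ , _ , y₂≢y₃)) = contradiction refl y₂≢y₃
  layer-twoNeighbours s i (w , u r₂ j₂ , u r₃ j₃ , (x~y₁ , x~y₂ , x~y₃) , (_ , _ , y₂≢y₃)) =
    topNeighbours s (apex~⇒top s i x~y₁) x~y₂ x~y₃ y₂≢y₃
  layer-twoNeighbours s i (u r₁ j₁ , w , u r₃ j₃ , (x~y₁ , x~y₂ , x~y₃) , (_ , y₁≢y₃ , _)) =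
    topNeighbours s (apex~⇒top s i x~y₂) x~y₁ x~y₃ y₁≢y₃
  layer-twoNeighbours s i (u r₁ j₁ , u r₂ j₂ , w , (x~y₁ , x~y₂ , x~y₃) , (y₁≢y₂ , _ , _)) =
    topNeighbours s (apex~⇒top s i x~y₃) x~y₁ x~y₂ y₁≢y₂
  layer-twoNeighbours s i (u r₁ j₁ , u r₂ j₂ , u r₃ j₃ , (x~y₁ , x~y₂ , x~y₃) , (y₁≢y₂ , y₁≢y₃ , y₂≢y₃))
    with j₁ Fin.≟ j₂ | j₁ Fin.≟ j₃
  ... | no j₁≢j₂ | _        = j₁ , j₂ , j₁≢j₂ , neighbourOf s r₁ x~y₁ , neighbourOf s r₂ x~y₂
  ... | yes refl | no j₁≢j₃ = j₁ , j₃ , j₁≢j₃ , neighbourOf s r₁ x~y₁ , neighbourOf s r₃ x~y₃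
  ... | yes refl | yes refl with layerAdj-atMostTwo (layerOf s r₁ x~y₁) (layerOf s r₂ x~y₂) (layerOf s r₃ x~y₃)
  ...   | inj₁ r₁≡r₂        = contradiction (cong (λ r → u r j₁) (toℕ-injective r₁≡r₂)) y₁≢y₂
  ...   | inj₂ (inj₁ r₁≡r₃) = contradiction (cong (λ r → u r j₁) (toℕ-injective r₁≡r₃)) y₁≢y₃
  ...   | inj₂ (inj₂ r₂≡r₃) = contradiction (cong (λ r → u r j₁) (toℕ-injective r₂≡r₃)) y₂≢y₃

  private
    ~-sym : ∀ {i j} → adj G i j ≡ true → adj G j i ≡ true
    ~-sym {i} {j} i~j = trans (SimpleGraph.sym G j i) i~j

  -- A shadow of y meets u s l, so its layer is adjacent to s, and u s′ i, so its index is
  -- adjacent to i; hence it is adjacent to u s i, unless it is w, which one of them excludes.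
  crossedNeighbour⇒notShadowed : ∀ s s′ {i l} y → u s i ~ y ≡ true →
    y ~ u s l ≡ true → l ≢ i → y ~ u s′ i ≡ true → s′ ≢ s →
    w ~ u s l ≡ false ⊎ w ~ u s′ i ≡ false → ¬ Shadowed _~_ (u s i)
  crossedNeighbour⇒notShadowed s s′ {i} {l} y x~y y~v₁ l≢i y~v₂ s′≢s w≁v x-shadowed with x-shadowed y x~y
  ... | z , z≁x , z-covers =
    shadow-adjacent z (z-covers (u s l) y~v₁ (l≢i ∘ u-injectiveʳ)) (z-covers (u s′ i) y~v₂ (s′≢s ∘ u-injectiveˡ)) z≁x
    where
    shadow-adjacent : ∀ z → z ~ u s l ≡ true → z ~ u s′ i ≡ true → z ~ u s i ≢ false
    shadow-adjacent w       w~v₁ w~v₂ _   =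
      [ (λ w≁v₁ → contradiction (trans (sym w~v₁) w≁v₁) λ ())
      , (λ w≁v₂ → contradiction (trans (sym w~v₂) w≁v₂) λ ())
      ] w≁v
    shadow-adjacent (u r m) z~v₁ z~v₂ z≁x =
      contradiction (trans (sym z≁x) (trans (~-layerAdj r s (layerOf r s z~v₁)) (neighbourOf r s′ z~v₂))) λ ()

  path₂⇒layer-notShadowed : ∀ s {i} → Path₂ G i → ¬ Shadowed _~_ (u s i)
  path₂⇒layer-notShadowed zero {i} (j , l , i~j , j~l , l≢i) x-shadowed =
    crossedNeighbour⇒notShadowed zero one (u zero j)
      (trans (~-layerAdj zero zero bottom) i~j)
      (trans (~-layerAdj zero zero bottom) j~l) l≢i
      (trans (~-layerAdj zero one (subst (LayerAdj 0) (sym toℕ-one) (up 0))) (~-sym i~j)) one≢zero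
      (inj₁ (apex≁ zero l (<⇒≢ 1≤t))) x-shadowed
    where
    one : Fin (suc t)
    one = layerAt 1 1≤t
    toℕ-one : toℕ one ≡ 1
    toℕ-one = toℕ-layerAt 1 1≤t
    one≢zero : one ≢ zero
    one≢zero eq with trans (sym toℕ-one) (cong toℕ eq)
    ... | ()
  path₂⇒layer-notShadowed (suc s₀) {i} (j , l , i~j , j~l , l≢i) x-shadowed =
    crossedNeighbour⇒notShadowed (suc s₀) s₂ (u (inject₁ s₀) j)
      (trans (~-layerAdj (suc s₀) (inject₁ s₀) (layerAdj-suc-inject₁ s₀)) i~j)
      (trans (~-layerAdj (inject₁ s₀) (suc s₀) (layerAdj-sym (layerAdj-suc-inject₁ s₀))) j~l) l≢i
      (trans (~-layerAdj (inject₁ s₀) s₂ y~s₂) (~-sym i~j)) s₂≢s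
      (inj₂ (apex≁ s₂ i s₂≢t)) x-shadowed
    where
    s₂≤t : pred (toℕ s₀) ≤ t
    s₂≤t = ≤-trans pred[n]≤n (toℕ≤n s₀)
    s₂ : Fin (suc t)
    s₂ = layerAt (pred (toℕ s₀)) s₂≤t
    toℕ-s₂ : toℕ s₂ ≡ pred (toℕ s₀)
    toℕ-s₂ = toℕ-layerAt (pred (toℕ s₀)) s₂≤t
    y~s₂ : LayerAdj (toℕ (inject₁ s₀)) (toℕ s₂)
    y~s₂ = subst₂ LayerAdj (sym (toℕ-inject₁ s₀)) (sym toℕ-s₂) (layerAdj-sym (layerAdj-pred (toℕ s₀)))
    s₂≤s₀ : toℕ s₂ ≤ toℕ s₀
    s₂≤s₀ = ≤-trans (≤-reflexive toℕ-s₂) pred[n]≤n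
    s₂≢s : s₂ ≢ suc s₀
    s₂≢s eq = <⇒≢ (s≤s s₂≤s₀) (cong toℕ eq)
    s₂≢t : toℕ s₂ ≢ t
    s₂≢t = <⇒≢ (≤-<-trans s₂≤s₀ (toℕ<n s₀))

  module _ (twin-free : TwinFree G) (3≤n : 3 ≤ n) where

    apex-fixed : ∀ (F : Automorphism _~_) → to F w ≡ w
    apex-fixed F with to F w | shadowed-preserved F {w} apex-shadowed | threeNeighbours-preserved F {w} (apex-threeNeighbours 3≤n)
    ... | w     | _           | _        = refl
    ... | u s i | Fw-shadowed | Fw-three =
      contradiction Fw-shadowed (path₂⇒layer-notShadowed s (twinFree⇒path₂ G twin-free (layer-twoNeighbours s i Fw-three)))

    module _ (no-isolated : NoIsolated G) where

      InLayer : Fin (suc t) → MVert n t → Set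
      InLayer s v = ∃ λ j → v ≡ u s j

      LayerPreserved : Fin (suc t) → Set
      LayerPreserved s = ∀ (F : Automorphism _~_) i → InLayer s (to F (u s i))

      apexNeighbour-inTopLayer : ∀ {s} → toℕ s ≡ t → ∀ v → v ~ w ≡ true → InLayer s v
      apexNeighbour-inTopLayer s≡t w ()
      apexNeighbour-inTopLayer s≡t (u r j) v~w =
        j , cong (λ r → u r j) (toℕ-injective (trans (apex~⇒top r j v~w) (sym s≡t)))

      top-layerPreserved : ∀ s → toℕ s ≡ t → LayerPreserved s
      top-layerPreserved s s≡t F i = apexNeighbour-inTopLayer s≡t (to F (u s i)) (begin
        to F (u s i) ~ w       ≡⟨ cong (to F (u s i) ~_) (sym (apex-fixed F)) ⟩
        to F (u s i) ~ to F w  ≡⟨ preserves F (u s i) w ⟩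
        u s i ~ w              ≡⟨ apex~ s i s≡t ⟩
        true                   ∎)
        where open ≡-Reasoning

      -- The image of u s i is adjacent to that of u (s + 1) j, which lies in layer s + 1, so it
      -- lies in layer s or s + 2; the latter is excluded since the inverse preserves layer s + 2.
      lower-layerPreserved : ∀ s → toℕ s < t → (∀ {r} → r > s → LayerPreserved r) → LayerPreserved s
      lower-layerPreserved s s<t higher F i = classify (to F (u s i)) refl
        where
        open ≡-Reasoning
        j = proj₁ (no-isolated i)
        i~j = proj₂ (no-isolated i)
        s₁ : Fin (suc t)
        s₁ = layerAt (suc (toℕ s)) s<t
        toℕ-s₁ : toℕ s₁ ≡ suc (toℕ s)
        toℕ-s₁ = toℕ-layerAt (suc (toℕ s)) s<t
        j′ = proj₁ (higher (≤-reflexive (sym toℕ-s₁)) F j)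
        Fs₁j≡ = proj₂ (higher (≤-reflexive (sym toℕ-s₁)) F j)
        Fx~Fs₁j : to F (u s i) ~ u s₁ j′ ≡ true
        Fx~Fs₁j = begin
          to F (u s i) ~ u s₁ j′        ≡⟨ cong (to F (u s i) ~_) (sym Fs₁j≡) ⟩
          to F (u s i) ~ to F (u s₁ j)  ≡⟨ preserves F (u s i) (u s₁ j) ⟩
          u s i ~ u s₁ j                ≡⟨ ~-layerAdj s s₁ (subst (LayerAdj (toℕ s)) (sym toℕ-s₁) (up (toℕ s))) ⟩
          adj G i j                     ≡⟨ i~j ⟩
          true                          ∎
        classify : ∀ v → to F (u s i) ≡ v → InLayer s (to F (u s i))
        classify w Fx≡w = contradiction (to-injective F (trans Fx≡w (sym (apex-fixed F)))) λ ()
        classify (u r i′) Fx≡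
          with layerAdj-suc (subst (LayerAdj (toℕ r)) toℕ-s₁ (layerOf r s₁ (subst (λ v → v ~ u s₁ j′ ≡ true) Fx≡ Fx~Fs₁j)))
        ... | inj₁ r≡s    = i′ , trans Fx≡ (cong (λ r → u r i′) (toℕ-injective r≡s))
        ... | inj₂ r≡s+2 with higher {r} (subst (toℕ s <_) (sym r≡s+2) (s≤s (n≤1+n (toℕ s)))) (inverse F) i′
        ...   | i″ , F⁻¹ri′≡ =
          contradiction (cong toℕ (u-injectiveˡ x≡ri″)) (λ s≡r → <⇒≢ (s≤s (n≤1+n (toℕ s))) (trans s≡r r≡s+2))
          where
          x≡ri″ : u s i ≡ u r i″
          x≡ri″ = trans (sym (strictlyInverseʳ F (u s i))) (trans (cong (from F) Fx≡) F⁻¹ri′≡)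

      layerPreserved : ∀ s → LayerPreserved s
      layerPreserved = All.wfRec >-wellFounded _ LayerPreserved step
        where
        step : ∀ s → (∀ {r} → r > s → LayerPreserved r) → LayerPreserved s
        step s higher with toℕ s ≟ t
        ... | yes s≡t = top-layerPreserved s s≡t
        ... | no  s≢t = lower-layerPreserved s (≤∧≢⇒< (toℕ≤pred[n] s) s≢t) higher

      module _ (F : Automorphism _~_) where

        private
          π π⁻¹ : Fin n → Fin n
          π   i = proj₁ (layerPreserved zero F i)
          π⁻¹ i = proj₁ (layerPreserved zero (inverse F) i)

          π-spec : ∀ i → to F (u zero i) ≡ u zero (π i)
          π-spec i = proj₂ (layerPreserved zero F i)

          π⁻¹-spec : ∀ i → from F (u zero i) ≡ u zero (π⁻¹ i)
          π⁻¹-spec i = proj₂ (layerPreserved zero (inverse F) i)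

          π∘π⁻¹ : ∀ i → π (π⁻¹ i) ≡ i
          π∘π⁻¹ i = u-injectiveʳ (begin
            u zero (π (π⁻¹ i))         ≡⟨ sym (π-spec (π⁻¹ i)) ⟩
            to F (u zero (π⁻¹ i))      ≡⟨ cong (to F) (sym (π⁻¹-spec i)) ⟩
            to F (from F (u zero i))   ≡⟨ strictlyInverseˡ F (u zero i) ⟩
            u zero i                   ∎)
            where open ≡-Reasoning

          π⁻¹∘π : ∀ i → π⁻¹ (π i) ≡ i
          π⁻¹∘π i = u-injectiveʳ (begin
            u zero (π⁻¹ (π i))         ≡⟨ sym (π⁻¹-spec (π i)) ⟩
            from F (u zero (π i))      ≡⟨ cong (from F) (sym (π-spec i)) ⟩
            from F (to F (u zero i))   ≡⟨ strictlyInverseʳ F (u zero i) ⟩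
            u zero i                   ∎)
            where open ≡-Reasoning

        induced : Permutation′ n
        induced = permutation π π⁻¹ π∘π⁻¹ π⁻¹∘π

        induced-isAut : IsAut (adj G) induced
        induced-isAut i j = begin
          adj G (π i) (π j)                ≡⟨ sym (~-layerAdj zero zero bottom) ⟩
          u zero (π i) ~ u zero (π j)      ≡⟨ sym (cong₂ _~_ (π-spec i) (π-spec j)) ⟩
          to F (u zero i) ~ to F (u zero j) ≡⟨ preserves F (u zero i) (u zero j) ⟩
          u zero i ~ u zero j              ≡⟨ ~-layerAdj zero zero bottom ⟩
          adj G i j                        ∎
          where open ≡-Reasoning

        to≡mapVertex : ∀ v → to F v ≡ mapVertex (induced ⟨$⟩ʳ_) v
        to≡mapVertex w       = apex-fixed F
        to≡mapVertex (u s i) = <-weakInduction LayerMapped π-spec step s i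
          where
          LayerMapped : Fin (suc t) → Set
          LayerMapped s = ∀ i → to F (u s i) ≡ u s (π i)
          step : ∀ s → LayerMapped (inject₁ s) → LayerMapped (suc s)
          step s below i = trans Fx≡ (cong (u (suc s)) (twin-free i′ (π i) sameNeighbours))
            where
            i′ = proj₁ (layerPreserved (suc s) F i)
            Fx≡ = proj₂ (layerPreserved (suc s) F i)
            sameNeighbours : ∀ x → adj G i′ x ≡ adj G (π i) x
            sameNeighbours x = begin
              adj G i′ x                                     ≡⟨ cong (adj G i′) (sym (π∘π⁻¹ x)) ⟩
              adj G i′ (π y)                                 ≡⟨ sym (~-layerAdj (suc s) (inject₁ s) (layerAdj-suc-inject₁ s)) ⟩
              u (suc s) i′ ~ u (inject₁ s) (π y)             ≡⟨ sym (cong₂ _~_ Fx≡ (below y)) ⟩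
              to F (u (suc s) i) ~ to F (u (inject₁ s) y)    ≡⟨ preserves F (u (suc s) i) (u (inject₁ s) y) ⟩
              u (suc s) i ~ u (inject₁ s) y                  ≡⟨ ~-layerAdj (suc s) (inject₁ s) (layerAdj-suc-inject₁ s) ⟩
              adj G i y                                      ≡⟨ sym (induced-isAut i y) ⟩
              adj G (π i) (π y)                              ≡⟨ cong (adj G (π i)) (π∘π⁻¹ x) ⟩
              adj G (π i) x                                  ∎
              where
              open ≡-Reasoning
              y = π⁻¹ x

      automorphism-isLift : ∀ σ → IsAut (mycielskian t G) σ →
        Σ (Permutation′ n) λ π → IsAut (adj G) π × (∀ x → σ ⟨$⟩ʳ x ≡ lift π ⟨$⟩ʳ x)
      automorphism-isLift σ σ-aut = induced F , induced-isAut F , σ≡lift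
        where
        F = asAutomorphism σ σ-aut
        σ≡lift : ∀ x → σ ⟨$⟩ʳ x ≡ lift (induced F) ⟨$⟩ʳ x
        σ≡lift x = begin
          σ ⟨$⟩ʳ x                           ≡⟨ sym (encode-decode (σ ⟨$⟩ʳ x)) ⟩
          encode (decode (σ ⟨$⟩ʳ x))         ≡⟨ cong (λ y → encode (decode (σ ⟨$⟩ʳ y))) (sym (encode-decode x)) ⟩
          encode (to F (decode x))           ≡⟨ cong encode (to≡mapVertex F (decode x)) ⟩
          lift (induced F) ⟨$⟩ʳ x            ∎
          where open ≡-Reasoning

module MycielskianDeterminingSets {n} (G : SimpleGraph n) {k} (twin-free : TwinFree G) (no-isolated : NoIsolated G)
  (det-G : DetEq (adj G) k) (2≤k : 2 ≤ k) {t} (k∸1≤t : k ∸ 1 ≤ t) where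

  open VertexCode n t
  open MycielskianPermutations G t

  private
    M = mycielskian t G
    S₀ = proj₁ (proj₁ det-G)
    S₀-determining = proj₁ (proj₂ (proj₁ det-G))
    ∣S₀∣≡k = proj₂ (proj₂ (proj₁ det-G))
    minimal = proj₂ det-G

  1≤k : 1 ≤ k
  1≤k = ≤-trans (s≤s z≤n) 2≤k

  1≤t : 1 ≤ t
  1≤t = ≤-trans (∸-monoˡ-≤ 1 2≤k) k∸1≤t

  k≤1+t : k ≤ suc t
  k≤1+t = ≤-trans (m≤n+m∸n k 1) (s≤s k∸1≤t)

  3≤n : 3 ≤ n
  3≤n = ≤-trans (s≤s 2≤k) (det<N det-G 1≤k)

  open MycielskianAutomorphisms G 1≤t using (automorphism-isLift)

  determining-lowerBound : ∀ S → Determining M S → k ≤ ∣ S ∣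
  determining-lowerBound S S-determining =
    ≤-trans (minimal _ projection-determining) (∣image∣≤∣p∣ (project ∘ decode) S)
    where
    -- w may go anywhere: lifts fix w
    project : MVert n t → Fin n
    project w       = inject≤ zero 3≤n
    project (u _ i) = i
    projection-determining : Determining (adj G) (image (project ∘ decode) S)
    projection-determining π π-aut π-fixes =
      lift-identity⁻¹ {π} (S-determining (lift π) (lift-isAut {π} π-aut) lift-fixes-S)
      where
      lift-fixes-S : ∀ x → x ∈ S → lift π ⟨$⟩ʳ x ≡ x
      lift-fixes-S x x∈S = lift-fixes {π} x λ x≡u →
        π-fixes _ (subst (_∈ image (project ∘ decode) S) (cong project x≡u) (∈image⁺ (project ∘ decode) x∈S))

  -- clamping by ⊓ t only matters off S₀, where ranks can reach k = t + 1
  assignedLayer : Fin n → Fin (suc t)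
  assignedLayer i = layerAt (rank S₀ i ⊓ t) (m⊓n≤n _ t)

  toℕ-assignedLayer : ∀ {i} → i ∈ S₀ → toℕ (assignedLayer i) ≡ rank S₀ i
  toℕ-assignedLayer {i} i∈S₀ = trans (toℕ-layerAt (rank S₀ i ⊓ t) (m⊓n≤n _ t)) (m≤n⇒m⊓n≡m rank≤t)
    where
    rank≤t : rank S₀ i ≤ t
    rank≤t = ≤-pred (≤-trans (rank<∣p∣ i∈S₀) (subst (_≤ suc t) (sym ∣S₀∣≡k) k≤1+t))

  tag : Fin n → Fin (suc (suc t * n))
  tag i = encode (u (assignedLayer i) i)

  T : Subset (suc (suc t * n))
  T = image tag S₀

  tag-injective : Injective _≡_ _≡_ tag
  tag-injective {i} {j} = u-injectiveʳ ∘ encode-injective {u (assignedLayer i) i} {u (assignedLayer j) j}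

  ∣T∣≡k : ∣ T ∣ ≡ k
  ∣T∣≡k = trans (∣image∣≡∣p∣ tag-injective S₀) ∣S₀∣≡k

  T-rigid : Rigid M T
  T-rigid σ σ-aut maps-into with automorphism-isLift twin-free 3≤n no-isolated σ σ-aut
  ... | π , π-aut , σ≡lift = λ x → trans (σ≡lift x) (lift-fixes {π} x λ _ → π-identity _)
    where
    π-fixes-S₀ : ∀ i → i ∈ S₀ → π ⟨$⟩ʳ i ≡ i
    π-fixes-S₀ i i∈S₀ with ∈image⁻ tag S₀ (maps-into (tag i) (∈image⁺ tag i∈S₀))
    ... | j , j∈S₀ , tag-j≡σ-tag-i = trans (sym (u-injectiveʳ tagged)) (rank-injective j∈S₀ i∈S₀ sameRank)
      where
      tagged : u (assignedLayer j) j ≡ u (assignedLayer i) (π ⟨$⟩ʳ i)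
      tagged = encode-injective {u (assignedLayer j) j} {u (assignedLayer i) (π ⟨$⟩ʳ i)}
        (trans tag-j≡σ-tag-i (trans (σ≡lift (tag i)) (lift-u π (assignedLayer i) i)))
      sameRank : rank S₀ j ≡ rank S₀ i
      sameRank = trans (sym (toℕ-assignedLayer j∈S₀)) (trans (cong toℕ (u-injectiveˡ tagged)) (toℕ-assignedLayer i∈S₀))
    π-identity : ∀ i → π ⟨$⟩ʳ i ≡ i
    π-identity = S₀-determining π π-aut π-fixes-S₀

  k≤N∸k : k ≤ suc (suc t * n) ∸ k
  k≤N∸k = m+n≤o⇒m≤o∸n k (≤-trans (+-mono-≤ k≤n (≤-trans k≤n n≤t*n)) (n≤1+n _))
    where
    k≤n : k ≤ n
    k≤n = ≤-trans (≤-reflexive (sym ∣S₀∣≡k)) (∣p∣≤n S₀)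
    n≤t*n : n ≤ t * n
    n≤t*n = ≤-trans (≤-reflexive (sym (*-identityˡ n))) (*-monoˡ-≤ n 1≤t)

theorem4 : ∀ {n} (G : SimpleGraph n) (k : ℕ) → TwinFree G → NoIsolated G →
    DetEq (adj G) k → 2 ≤ k → ∀ (t : ℕ) → k ∸ 1 ≤ t →
    DetEq (mycielskian t G) k × DistEq (mycielskian t G) 2 × CostEq (mycielskian t G) k
theorem4 G k twin-free no-isolated det-G 2≤k t k∸1≤t =
  rigid-detEq  M determining-lowerBound T-rigid ∣T∣≡k ,
  rigid-distEq M determining-lowerBound T-rigid 1≤k ,
  rigid-costEq M determining-lowerBound T-rigid ∣T∣≡k k≤N∸k
  where
  open MycielskianDeterminingSets G twin-free no-isolated det-G 2≤k k∸1≤t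
  M = mycielskian t G
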